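{- Let $\mathbf A,\mathbf B,\mathbf C$ be hoops. (i) Let $(f,g)$ be a left-associated pair with respect to $(\mathbf A,\mathbf B,\mathbf C)$, and write $g(c)=(g_1(c),g_2(c))$ for $c\in C$. Define $\overline g\colon C\to B$ by $\overline g(c)=g_2(c)$ and $\overline f\colon |\mathbf B\ltimes_{\overline g}\mathbf C|\to A$ by $\overline f(b,c)=f(b)\wedge g_1(c)$. Then $\alpha(f,g):=(\overline f,\overline g)$ is a right-associated pair with respect to $(\mathbf A,\mathbf B,\mathbf C)$. (ii) Let $(f,g)$ be a right-associated pair with respect to $(\mathbf A,\mathbf B,\mathbf C)$. Define $\overline f\colon B\to A$ by $\overline f(b)=f(b,1)$ and $\overline g\colon C\to |\mathbf A\ltimes_{\overline f}\mathbf B|$ by $\overline g(c)=(f(g(c),c),\,g(c))$. Then $\beta(f,g):=(\overline f,\overline g)$ is a left-associated pair with respect to $(\mathbf A,\mathbf B,\mathbf C)$. (iii) The maps $\alpha$ and $\beta$ are mutually inverse bijections between the set of left-associated pairs and the set of right-associated pairs with respect to $(\mathbf A,\mathbf B,\mathbf C)$. Moreover, if $\alpha(f,g)=(\overline f,\overline g)$ (equivalently $(f,g)=\beta(\overline f,\overline g)$), then $(\mathbf A\ltimes_f\mathbf B)\ltimes_g\mathbf C\cong\mathbf A\ltimes_{\overline f}(\mathbf B\ltimes_{\overline g}\mathbf C)$.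
   Context: A hoop is an algebra $\mathbf A=(A;\cdot,\rightarrow,1)$ of type $\langle 2,2,0\rangle$ such that $(A;\cdot,1)$ is a commutative monoid and the identities $x\rightarrow x=1$, $(x\cdot y)\rightarrow z=x\rightarrow(y\rightarrow z)$ and $x\cdot(x\rightarrow y)=y\cdot(y\rightarrow x)$ hold. The order is $x\leq y$ iff $x\rightarrow y=1$; infima exist and $x\wedge y=x\cdot(x\rightarrow y)$. A map $f\colon B\to A$ between hoops is a product morphism if $f(1)=1$ and $f(x)\cdot f(y)=f(x\cdot y)=f(x)\wedge f(y)=f(x\wedge y)$ for all $x,y\in B$. For such $f$, the $f$-product $\mathbf A\ltimes_f\mathbf B$ is the hoop whose universe $|\mathbf A\ltimes_f\mathbf B|$ is $\{(a,x)\in A\times B\mid a\leq f(x)\}$, with constant $(1,1)$ and operations $(a,x)\cdot(b,y)=(a\cdot b,\,x\cdot y)$ and $(a,x)\rightarrow(b,y)=(f(x\rightarrow y)\wedge(a\rightarrow b),\,x\rightarrow y)$; its order and meet are computed componentwise. A pair $(f,g)$ is a left-associated pair of product morphisms with respect to $(\mathbf A,\mathbf B,\mathbf C)$ if $f\colon \mathbf B\to\mathbf A$ and $g\colon\mathbf C\to\mathbf A\ltimes_f\mathbf B$ are product morphisms; it is a right-associated pair with respect to $(\mathbf A,\mathbf B,\mathbf C)$ if $g\colon\mathbf C\to\mathbf B$ and $f\colon\mathbf B\ltimes_g\mathbf C\to\mathbf A$ are product morphisms. Isomorphism means hoop isomorphism. -}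

module Defs where

open import Level using (Level; _⊔_; suc)
open import Data.Product using (Σ; _×_; _,_; proj₁; proj₂; ∃)
open import Data.Unit.Polymorphic using (⊤)
open import Relation.Binary.PropositionalEquality using (_≡_)

record RawHoop (ℓ : Level) : Set (suc ℓ) where
  infixl 7 _·_
  infixr 5 _⇒_
  field
    Carrier : Set ℓ
    _·_     : Carrier → Carrier → Carrier
    _⇒_     : Carrier → Carrier → Carrier
    one     : Carrier

  _≤_ : Carrier → Carrier → Set ℓ
  x ≤ y = (x ⇒ y) ≡ one

  _∧_ : Carrier → Carrier → Carrier
  x ∧ y = x · (x ⇒ y)

record Hoop (ℓ : Level) : Set (suc ℓ) where
  field
    raw : RawHoop ℓ
  open RawHoop raw public
  field
    ·-assoc     : ∀ x y z → (x · y) · z ≡ x · (y · z)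
    ·-comm      : ∀ x y → x · y ≡ y · x
    ·-identityˡ : ∀ x → one · x ≡ x
    ·-identityʳ : ∀ x → x · one ≡ x
    ⇒-refl      : ∀ x → (x ⇒ x) ≡ one
    ⇒-curry     : ∀ x y z → ((x · y) ⇒ z) ≡ (x ⇒ (y ⇒ z))
    ·-⇒-swap    : ∀ x y → x · (x ⇒ y) ≡ y · (y ⇒ x)

-- "Presented" hoops: a raw hoop on a carrier X together with a predicate
-- U ⊆ X singling out the universe.  The f-products are presented as the
-- subset { (a , x) | a ≤ f x } of A × B, whose operations are the
-- restrictions of the (everywhere-defined) formulas on A × B.

record PHoop (ℓ : Level) : Set (suc ℓ) where
  field
    raw : RawHoop ℓ
  open RawHoop raw public
  field
    U : Carrier → Set ℓ

⌊_⌋ : ∀ {ℓ} → Hoop ℓ → PHoop ℓ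
⌊ H ⌋ = record { raw = Hoop.raw H ; U = λ _ → ⊤ }

syntax ⋉-product P Q f = P ⋉[ f ] Q
⋉-product : ∀ {ℓ} (P Q : PHoop ℓ) → (PHoop.Carrier Q → PHoop.Carrier P) → PHoop ℓ
⋉-product {ℓ} P Q f = record
  { raw = record
      { Carrier = P.Carrier × Q.Carrier
      ; _·_ = λ { (a , x) (b , y) → (a P.· b , x Q.· y) }
      ; _⇒_ = λ { (a , x) (b , y) → (f (x Q.⇒ y) P.∧ (a P.⇒ b) , x Q.⇒ y) }
      ; one = (P.one , Q.one)
      }
  ; U = λ { (a , x) → P.U a × Q.U x × (a P.≤ f x) }
  }
  where
    module P = PHoop P
    module Q = PHoop Q

record IsProductMorphism {ℓ} (Q P : PHoop ℓ) (f : PHoop.Carrier Q → PHoop.Carrier P) : Set ℓ where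
  private
    module P = PHoop P
    module Q = PHoop Q
  field
    preserves-U : ∀ x → Q.U x → P.U (f x)
    f-one       : f Q.one ≡ P.one
    f-·         : ∀ x y → Q.U x → Q.U y → (f x P.· f y) ≡ f (x Q.· y)
    f-·-∧       : ∀ x y → Q.U x → Q.U y → f (x Q.· y) ≡ (f x P.∧ f y)
    f-∧         : ∀ x y → Q.U x → Q.U y → (f x P.∧ f y) ≡ f (x Q.∧ y)

record _≅_ {ℓ} (P Q : PHoop ℓ) : Set ℓ where
  private
    module P = PHoop P
    module Q = PHoop Q
  field
    to        : P.Carrier → Q.Carrier
    from      : Q.Carrier → P.Carrier
    to-U      : ∀ x → P.U x → Q.U (to x)
    from-U    : ∀ y → Q.U y → P.U (from y)
    from∘to   : ∀ x → P.U x → from (to x) ≡ x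
    to∘from   : ∀ y → Q.U y → to (from y) ≡ y
    to-one    : to P.one ≡ Q.one
    to-·      : ∀ x y → P.U x → P.U y → to (x P.· y) ≡ (to x Q.· to y)
    to-⇒      : ∀ x y → P.U x → P.U y → to (x P.⇒ y) ≡ (to x Q.⇒ to y)

module _ {ℓ} (A B C : Hoop ℓ) where
  private
    module A = Hoop A
    module B = Hoop B
    module C = Hoop C

  LeftPair : (f : B.Carrier → A.Carrier) (g : C.Carrier → A.Carrier × B.Carrier) → Set ℓ
  LeftPair f g = IsProductMorphism ⌊ B ⌋ ⌊ A ⌋ f
               × IsProductMorphism ⌊ C ⌋ (⌊ A ⌋ ⋉[ f ] ⌊ B ⌋) g

  RightPair : (f : B.Carrier × C.Carrier → A.Carrier) (g : C.Carrier → B.Carrier) → Set ℓ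
  RightPair f g = IsProductMorphism ⌊ C ⌋ ⌊ B ⌋ g
                × IsProductMorphism (⌊ B ⌋ ⋉[ g ] ⌊ C ⌋) ⌊ A ⌋ f

  α-f : (B.Carrier → A.Carrier) → (C.Carrier → A.Carrier × B.Carrier)
      → B.Carrier × C.Carrier → A.Carrier
  α-f f g (b , c) = f b A.∧ proj₁ (g c)

  α-g : (B.Carrier → A.Carrier) → (C.Carrier → A.Carrier × B.Carrier)
      → C.Carrier → B.Carrier
  α-g f g c = proj₂ (g c)

  β-f : (B.Carrier × C.Carrier → A.Carrier) → (C.Carrier → B.Carrier)
      → B.Carrier → A.Carrier
  β-f f g b = f (b , C.one)

  β-g : (B.Carrier × C.Carrier → A.Carrier) → (C.Carrier → B.Carrier)
      → C.Carrier → A.Carrier × B.Carrier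
  β-g f g c = (f (g c , c) , g c)

-- Images of product morphisms are idempotent, and for an idempotent p one has
-- p ∧ x = p · x.  Hence a map into a hoop is a product morphism as soon as it is
-- multiplicative, takes idempotent values and identifies x · y with x ∧ y; and in
-- A ⋉_h B the meet of a pair with idempotent first coordinate is again computed
-- by the product in that coordinate.  With these two observations the product
-- morphism conditions for α(f, g) and β(f, g), and the compatibility of the
-- reassociation ((a , b) , c) ↦ (a , (b , c)) with →, all reduce to rearranging
-- products of idempotents of A that absorb each other (q · p = p when p ≤ q).
module Submission where

open import Level using (Level)
open import Data.Product using (_×_; _,_; proj₁; proj₂)
open import Data.Unit.Polymorphic using (tt)
open import Relation.Binary.PropositionalEquality
  using (_≡_; refl; sym; trans; cong; cong₂; subst; isEquivalence; module ≡-Reasoning)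
open import Algebra.Bundles using (CommutativeSemigroup)
import Algebra.Definitions as AlgebraDefinitions
import Algebra.Properties.CommutativeSemigroup as CommutativeSemigroupProperties

open import Defs

open ≡-Reasoning
open IsProductMorphism

private
  variable
    ℓ : Level

module HoopProperties (H : Hoop ℓ) where
  open Hoop H
  open AlgebraDefinitions (_≡_ {A = Carrier}) public using (_IdempotentOn_)

  ·-commutativeSemigroup : CommutativeSemigroup ℓ ℓ
  ·-commutativeSemigroup = record
    { Carrier = Carrier
    ; _≈_ = _≡_
    ; _∙_ = _·_
    ; isCommutativeSemigroup = record
      { isSemigroup = record
        { isMagma = record { isEquivalence = isEquivalence ; ∙-cong = cong₂ _·_ }
        ; assoc = ·-assoc
        }
      ; comm = ·-comm
      }
    }

  open CommutativeSemigroupProperties ·-commutativeSemigroup public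
    using (interchange; x∙yz≈y∙xz; xy∙z≈y∙xz)

  ⇒-identityˡ : ∀ x → (one ⇒ x) ≡ x
  ⇒-identityˡ x = sym (begin
    x                                      ≡⟨ sym (·-identityʳ x) ⟩
    x · one                                ≡⟨ cong (x ·_) (sym x⇒1⇒x≡one) ⟩
    x · (x ⇒ (one ⇒ x))                    ≡⟨ ·-⇒-swap x (one ⇒ x) ⟩
    (one ⇒ x) · ((one ⇒ x) ⇒ x)            ≡⟨ cong₂ _·_ (sym x·x⇒1≡1⇒x) 1⇒x⇒x≡x⇒1⇒1 ⟩
    (x · (x ⇒ one)) · ((x ⇒ one) ⇒ one)    ≡⟨ ·-assoc x (x ⇒ one) _ ⟩
    x · ((x ⇒ one) · ((x ⇒ one) ⇒ one))    ≡⟨ cong (x ·_) (·-⇒-swap (x ⇒ one) one) ⟩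
    x · (one · (one ⇒ (x ⇒ one)))          ≡⟨ cong (x ·_) (·-identityˡ _) ⟩
    x · (one ⇒ (x ⇒ one))                  ≡⟨ cong (x ·_) 1⇒x⇒1≡x⇒1 ⟩
    x · (x ⇒ one)                          ≡⟨ x·x⇒1≡1⇒x ⟩
    one ⇒ x                                ∎)
    where
    x⇒1⇒x≡one : (x ⇒ (one ⇒ x)) ≡ one
    x⇒1⇒x≡one = trans (sym (⇒-curry x one x)) (trans (cong (_⇒ x) (·-identityʳ x)) (⇒-refl x))
    x·x⇒1≡1⇒x : x · (x ⇒ one) ≡ one ⇒ x
    x·x⇒1≡1⇒x = trans (·-⇒-swap x one) (·-identityˡ _)
    1⇒x⇒1≡x⇒1 : (one ⇒ (x ⇒ one)) ≡ (x ⇒ one)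
    1⇒x⇒1≡x⇒1 = trans (sym (⇒-curry one x one)) (cong (_⇒ one) (·-identityˡ x))
    1⇒x⇒x≡x⇒1⇒1 : ((one ⇒ x) ⇒ x) ≡ ((x ⇒ one) ⇒ one)
    1⇒x⇒x≡x⇒1⇒1 = begin
      (one ⇒ x) ⇒ x           ≡⟨ cong (_⇒ x) (sym x·x⇒1≡1⇒x) ⟩
      (x · (x ⇒ one)) ⇒ x     ≡⟨ cong (_⇒ x) (·-comm x _) ⟩
      ((x ⇒ one) · x) ⇒ x     ≡⟨ ⇒-curry _ x x ⟩
      (x ⇒ one) ⇒ (x ⇒ x)     ≡⟨ cong ((x ⇒ one) ⇒_) (⇒-refl x) ⟩
      (x ⇒ one) ⇒ one         ∎

  ⇒-zeroʳ : ∀ x → (x ⇒ one) ≡ one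
  ⇒-zeroʳ x = sym (begin
    one                         ≡⟨ sym (⇒-refl (x ⇒ one)) ⟩
    (x ⇒ one) ⇒ (x ⇒ one)       ≡⟨ sym (⇒-curry _ x one) ⟩
    ((x ⇒ one) · x) ⇒ one       ≡⟨ cong (_⇒ one) x⇒1·x≡x ⟩
    x ⇒ one                     ∎)
    where
    x⇒1·x≡x : (x ⇒ one) · x ≡ x
    x⇒1·x≡x = trans (·-comm _ x) (trans (·-⇒-swap x one)
                (trans (·-identityˡ _) (⇒-identityˡ x)))

  x·y≤y : ∀ x y → (x · y) ≤ y
  x·y≤y x y = trans (⇒-curry x y y) (trans (cong (x ⇒_) (⇒-refl y)) (⇒-zeroʳ x))

  x·y≤x : ∀ x y → (x · y) ≤ x
  x·y≤x x y = subst (_≤ x) (·-comm y x) (x·y≤y y x)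

  x·y≤z⇒x≤y⇒z : ∀ {x y z} → (x · y) ≤ z → x ≤ (y ⇒ z)
  x·y≤z⇒x≤y⇒z {x} {y} {z} x·y≤z = trans (sym (⇒-curry x y z)) x·y≤z

  y≤x⇒y : ∀ x y → y ≤ (x ⇒ y)
  y≤x⇒y x y = x·y≤z⇒x≤y⇒z (x·y≤x y x)

  x≤y⇒x∧y≡x : ∀ {x y} → x ≤ y → (x ∧ y) ≡ x
  x≤y⇒x∧y≡x {x} x≤y = trans (cong (x ·_) x≤y) (·-identityʳ x)

  ∧-comm : ∀ x y → (x ∧ y) ≡ (y ∧ x)
  ∧-comm = ·-⇒-swap

  ∧-idem : ∀ x → (x ∧ x) ≡ x
  ∧-idem x = x≤y⇒x∧y≡x (⇒-refl x)

  ∧-identityˡ : ∀ x → (one ∧ x) ≡ x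
  ∧-identityˡ x = trans (·-identityˡ _) (⇒-identityˡ x)

  ∧-identityʳ : ∀ x → (x ∧ one) ≡ x
  ∧-identityʳ x = x≤y⇒x∧y≡x (⇒-zeroʳ x)

  x∧y≤x : ∀ x y → (x ∧ y) ≤ x
  x∧y≤x x y = x·y≤x x (x ⇒ y)

  x∧y≤y : ∀ x y → (x ∧ y) ≤ y
  x∧y≤y x y = subst (_≤ y) (∧-comm y x) (x∧y≤x y x)

  x∧y≡x⇒x≤y : ∀ {x y} → (x ∧ y) ≡ x → x ≤ y
  x∧y≡x⇒x≤y {x} {y} x∧y≡x = subst (_≤ y) x∧y≡x (x∧y≤y x y)

  ≤-antisym : ∀ {x y} → x ≤ y → y ≤ x → x ≡ y
  ≤-antisym {x} {y} x≤y y≤x =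
    trans (sym (x≤y⇒x∧y≡x x≤y)) (trans (∧-comm x y) (x≤y⇒x∧y≡x y≤x))

  ≤⇒factor : ∀ {x y} → x ≤ y → x ≡ y · (y ⇒ x)
  ≤⇒factor {x} {y} x≤y = trans (sym (x≤y⇒x∧y≡x x≤y)) (∧-comm x y)

  ≤-trans : ∀ {x y z} → x ≤ y → y ≤ z → x ≤ z
  ≤-trans {x} {y} {z} x≤y y≤z = subst (_≤ z) (sym x≡) (x·y≤y _ z)
    where
    x≡ : x ≡ ((y ⇒ x) · (z ⇒ y)) · z
    x≡ = begin
      x                          ≡⟨ ≤⇒factor x≤y ⟩
      y · (y ⇒ x)                ≡⟨ ·-comm y _ ⟩
      (y ⇒ x) · y                ≡⟨ cong ((y ⇒ x) ·_) (trans (≤⇒factor y≤z) (·-comm z _)) ⟩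
      (y ⇒ x) · ((z ⇒ y) · z)    ≡⟨ sym (·-assoc _ _ _) ⟩
      ((y ⇒ x) · (z ⇒ y)) · z    ∎

  ·-monoʳ-≤ : ∀ z {x y} → x ≤ y → (z · x) ≤ (z · y)
  ·-monoʳ-≤ z {x} {y} x≤y = subst (_≤ (z · y)) (sym z·x≡) (x·y≤y _ _)
    where
    z·x≡ : z · x ≡ (y ⇒ x) · (z · y)
    z·x≡ = begin
      z · x                ≡⟨ cong (z ·_) (trans (≤⇒factor x≤y) (·-comm y _)) ⟩
      z · ((y ⇒ x) · y)    ≡⟨ x∙yz≈y∙xz z _ y ⟩
      (y ⇒ x) · (z · y)    ∎

  ∧-greatest : ∀ {x y z} → z ≤ x → z ≤ y → z ≤ (x ∧ y)
  ∧-greatest {x} {y} {z} z≤x z≤y =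
    subst (_≤ (x ∧ y)) (sym (≤⇒factor z≤x)) (·-monoʳ-≤ x x⇒z≤x⇒y)
    where
    x⇒z·x≡z : (x ⇒ z) · x ≡ z
    x⇒z·x≡z = trans (·-comm _ x) (sym (≤⇒factor z≤x))
    x⇒z≤x⇒y : (x ⇒ z) ≤ (x ⇒ y)
    x⇒z≤x⇒y = x·y≤z⇒x≤y⇒z (subst (_≤ y) (sym x⇒z·x≡z) z≤y)

  idempotent⇒∧≡· : ∀ {p} → _·_ IdempotentOn p → ∀ x → (p ∧ x) ≡ p · x
  idempotent⇒∧≡· {p} p·p≡p x =
    ≤-antisym p∧x≤p·x (∧-greatest (x·y≤x p x) (x·y≤y p x))
    where
    p∧x≡p·p∧x : (p ∧ x) ≡ p · (p ∧ x)
    p∧x≡p·p∧x = trans (cong (_· (p ⇒ x)) (sym p·p≡p)) (·-assoc p p _)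
    p∧x≤p·x : (p ∧ x) ≤ (p · x)
    p∧x≤p·x = subst (_≤ (p · x)) (sym p∧x≡p·p∧x) (·-monoʳ-≤ p (x∧y≤y p x))

  ·-idempotentOn : ∀ {p q} → _·_ IdempotentOn p → _·_ IdempotentOn q → _·_ IdempotentOn (p · q)
  ·-idempotentOn {p} {q} p·p≡p q·q≡q =
    trans (interchange p q p q) (cong₂ _·_ p·p≡p q·q≡q)

  idempotent-absorbs-≤ : ∀ {p q} → _·_ IdempotentOn q → p ≤ q → q · p ≡ p
  idempotent-absorbs-≤ {p} {q} q·q≡q p≤q =
    trans (sym (idempotent⇒∧≡· q·q≡q p)) (trans (∧-comm q p) (x≤y⇒x∧y≡x p≤q))

module _ {Q P : PHoop ℓ} {f : PHoop.Carrier Q → PHoop.Carrier P} where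
  private
    module P = PHoop P
    module Q = PHoop Q

  mkIsProductMorphism :
    (∀ x → Q.U x → P.U (f x)) →
    f Q.one ≡ P.one →
    (∀ x y → Q.U x → Q.U y → f x P.· f y ≡ f (x Q.· y)) →
    (∀ x y → Q.U x → Q.U y → f x P.∧ f y ≡ f x P.· f y) →
    (∀ x y → Q.U x → Q.U y → f (x Q.· y) ≡ f (x Q.∧ y)) →
    IsProductMorphism Q P f
  mkIsProductMorphism f-U f-one f-· f-∧≡· f-·≡f-∧ = record
    { preserves-U = f-U
    ; f-one = f-one
    ; f-· = f-·
    ; f-·-∧ = λ x y ux uy → trans (sym (f-· x y ux uy)) (sym (f-∧≡· x y ux uy))
    ; f-∧ = λ x y ux uy → trans (f-∧≡· x y ux uy) (trans (f-· x y ux uy) (f-·≡f-∧ x y ux uy))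
    }

module _ {Q : PHoop ℓ} (A : Hoop ℓ) {f : PHoop.Carrier Q → Hoop.Carrier A} where
  private
    module A = Hoop A
    module Q = PHoop Q
  open HoopProperties A

  mkIsProductMorphismToHoop :
    f Q.one ≡ A.one →
    (∀ x y → Q.U x → Q.U y → f x A.· f y ≡ f (x Q.· y)) →
    (∀ x → Q.U x → A._·_ IdempotentOn f x) →
    (∀ x y → Q.U x → Q.U y → f (x Q.· y) ≡ f (x Q.∧ y)) →
    IsProductMorphism Q ⌊ A ⌋ f
  mkIsProductMorphismToHoop f-one f-· f-idem =
    mkIsProductMorphism (λ _ _ → tt) f-one f-·
      (λ x _ ux _ → idempotent⇒∧≡· (f-idem x ux) _)

module ProductMorphismProperties {Q P : PHoop ℓ} {f : PHoop.Carrier Q → PHoop.Carrier P}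
                                 (f-pm : IsProductMorphism Q P f) where
  private
    module P = PHoop P
    module Q = PHoop Q

  f-·≡f-∧ : ∀ x y → Q.U x → Q.U y → f (x Q.· y) ≡ f (x Q.∧ y)
  f-·≡f-∧ x y ux uy = trans (f-·-∧ f-pm x y ux uy) (f-∧ f-pm x y ux uy)

  f·f≡f-∧ : ∀ x y → Q.U x → Q.U y → f x P.· f y ≡ f (x Q.∧ y)
  f·f≡f-∧ x y ux uy = trans (f-· f-pm x y ux uy) (f-·≡f-∧ x y ux uy)

module ProductMorphismIntoHoopProperties {Q : PHoop ℓ} (A : Hoop ℓ) {f : PHoop.Carrier Q → Hoop.Carrier A}
                                         (f-pm : IsProductMorphism Q ⌊ A ⌋ f) where
  private
    module A = Hoop A
    module Q = PHoop Q
  open HoopProperties A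
  open ProductMorphismProperties f-pm public

  f-idempotentOn : ∀ x → Q.U x → A._·_ IdempotentOn f x
  f-idempotentOn x ux = trans (f-· f-pm x x ux ux) (trans (f-·-∧ f-pm x x ux ux) (∧-idem (f x)))

module HoopProductMorphismProperties (B A : Hoop ℓ) {f : Hoop.Carrier B → Hoop.Carrier A}
                                     (f-pm : IsProductMorphism ⌊ B ⌋ ⌊ A ⌋ f) where
  private
    module A = Hoop A
    module B = Hoop B
    module HA = HoopProperties A
    module HB = HoopProperties B
  open ProductMorphismIntoHoopProperties A f-pm public

  f-mono-≤ : ∀ {x y} → x B.≤ y → f x A.≤ f y
  f-mono-≤ {x} {y} x≤y =
    HA.x∧y≡x⇒x≤y (trans (f-∧ f-pm x y tt tt) (cong f (HB.x≤y⇒x∧y≡x x≤y)))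

  f-·∧ : ∀ x y z → f (x B.· (y B.∧ z)) ≡ f y A.· f (x B.· z)
  f-·∧ x y z = begin
    f (x B.· (y B.∧ z))         ≡⟨ sym (f-· f-pm x _ tt tt) ⟩
    f x A.· f (y B.∧ z)         ≡⟨ cong (f x A.·_) (sym (f·f≡f-∧ y z tt tt)) ⟩
    f x A.· (f y A.· f z)       ≡⟨ HA.x∙yz≈y∙xz (f x) (f y) (f z) ⟩
    f y A.· (f x A.· f z)       ≡⟨ cong (f y A.·_) (f-· f-pm x z tt tt) ⟩
    f y A.· f (x B.· z)         ∎

  ⋉-∧-proj₁ : ∀ {a x a' x'} → A._·_ HA.IdempotentOn a → a' A.≤ f x' →
              proj₁ (PHoop._∧_ (⌊ A ⌋ ⋉[ f ] ⌊ B ⌋) (a , x) (a' , x')) ≡ a A.· a'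
  ⋉-∧-proj₁ {a} {x} {a'} {x'} a·a≡a a'≤fx' = begin
    a A.· (F A.∧ (a A.⇒ a'))    ≡⟨ cong (a A.·_) (HA.idempotent⇒∧≡· (f-idempotentOn _ tt) _) ⟩
    a A.· (F A.· (a A.⇒ a'))    ≡⟨ HA.x∙yz≈y∙xz a F _ ⟩
    F A.· (a A.∧ a')            ≡⟨ cong (F A.·_) (HA.idempotent⇒∧≡· a·a≡a a') ⟩
    F A.· (a A.· a')            ≡⟨ HA.x∙yz≈y∙xz F a a' ⟩
    a A.· (F A.· a')            ≡⟨ cong (a A.·_) (HA.idempotent-absorbs-≤ (f-idempotentOn _ tt) a'≤F) ⟩
    a A.· a'                    ∎
    where
    F = f (x B.⇒ x')
    a'≤F : a' A.≤ F
    a'≤F = HA.≤-trans a'≤fx' (f-mono-≤ (HB.y≤x⇒y x x'))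

module FromLeftPair (A B C : Hoop ℓ) {f : Hoop.Carrier B → Hoop.Carrier A}
                    {g : Hoop.Carrier C → Hoop.Carrier A × Hoop.Carrier B}
                    (lp : LeftPair A B C f g) where
  private
    module A = Hoop A
    module B = Hoop B
    module C = Hoop C
    module HA = HoopProperties A
    module HB = HoopProperties B
    module HC = HoopProperties C
    f-pm = proj₁ lp
    g-pm = proj₂ lp
    module F = HoopProductMorphismProperties B A f-pm
    module G = ProductMorphismProperties g-pm

  g₁ : C.Carrier → A.Carrier
  g₁ c = proj₁ (g c)

  g₂ : C.Carrier → B.Carrier
  g₂ = α-g A B C f g

  f̄ : B.Carrier × C.Carrier → A.Carrier
  f̄ = α-f A B C f g

  g₁≤f∘g₂ : ∀ c → g₁ c A.≤ f (g₂ c)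
  g₁≤f∘g₂ c = proj₂ (proj₂ (preserves-U g-pm c tt))

  g₁-idempotentOn : ∀ c → A._·_ HA.IdempotentOn g₁ c
  g₁-idempotentOn c = cong proj₁ (trans (G.f·f≡f-∧ c c tt tt) (cong g (HC.∧-idem c)))

  g₂-isProductMorphism : IsProductMorphism ⌊ C ⌋ ⌊ B ⌋ g₂
  g₂-isProductMorphism = record
    { preserves-U = λ _ _ → tt
    ; f-one = cong proj₂ (f-one g-pm)
    ; f-· = λ x y _ _ → cong proj₂ (f-· g-pm x y tt tt)
    ; f-·-∧ = λ x y _ _ → cong proj₂ (f-·-∧ g-pm x y tt tt)
    ; f-∧ = λ x y _ _ → cong proj₂ (f-∧ g-pm x y tt tt)
    }

  private
    module G₂ = HoopProductMorphismProperties C B g₂-isProductMorphism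

  g₁·≤f∘g₂⇒ : ∀ c c' → g₁ (c C.· c') A.≤ f (g₂ (c C.⇒ c'))
  g₁·≤f∘g₂⇒ c c' = HA.≤-trans (g₁≤f∘g₂ (c C.· c'))
    (F.f-mono-≤ (G₂.f-mono-≤ (HC.≤-trans (HC.x·y≤y c c') (HC.y≤x⇒y c c'))))

  f̄≡f·g₁ : ∀ b c → f̄ (b , c) ≡ f b A.· g₁ c
  f̄≡f·g₁ b c = HA.idempotent⇒∧≡· (F.f-idempotentOn b tt) (g₁ c)

  f̄-idempotentOn : ∀ b c → A._·_ HA.IdempotentOn f̄ (b , c)
  f̄-idempotentOn b c = subst (A._·_ HA.IdempotentOn_) (sym (f̄≡f·g₁ b c))
    (HA.·-idempotentOn (F.f-idempotentOn b tt) (g₁-idempotentOn c))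

  f̄-· : ∀ b c b' c' → f̄ (b , c) A.· f̄ (b' , c') ≡ f̄ (b B.· b' , c C.· c')
  f̄-· b c b' c' = begin
    f̄ (b , c) A.· f̄ (b' , c')               ≡⟨ cong₂ A._·_ (f̄≡f·g₁ b c) (f̄≡f·g₁ b' c') ⟩
    (f b A.· g₁ c) A.· (f b' A.· g₁ c')     ≡⟨ HA.interchange _ _ _ _ ⟩
    (f b A.· f b') A.· (g₁ c A.· g₁ c')     ≡⟨ cong₂ A._·_ (f-· f-pm b b' tt tt) (cong proj₁ (f-· g-pm c c' tt tt)) ⟩
    f (b B.· b') A.· g₁ (c C.· c')          ≡⟨ sym (f̄≡f·g₁ _ _) ⟩
    f̄ (b B.· b' , c C.· c')                 ∎

  f̄-·≡f̄-∧ : ∀ b c b' c' →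
            f̄ (b B.· b' , c C.· c') ≡ f̄ (b B.· (g₂ (c C.⇒ c') B.∧ (b B.⇒ b')) , c C.∧ c')
  f̄-·≡f̄-∧ b c b' c' = begin
    f̄ (b B.· b' , c C.· c')                        ≡⟨ f̄≡f·g₁ _ _ ⟩
    f (b B.· b') A.· g₁ (c C.· c')                 ≡⟨ cong (f (b B.· b') A.·_) (sym fZ-absorbs) ⟩
    f (b B.· b') A.· (f Z A.· g₁ (c C.· c'))       ≡⟨ HA.x∙yz≈y∙xz _ (f Z) _ ⟩
    f Z A.· (f (b B.· b') A.· g₁ (c C.· c'))       ≡⟨ cong (f Z A.·_) (cong₂ A._·_ (F.f-·≡f-∧ b b' tt tt)
                                                                              (cong proj₁ (G.f-·≡f-∧ c c' tt tt))) ⟩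
    f Z A.· (f (b B.∧ b') A.· g₁ (c C.∧ c'))       ≡⟨ sym (A.·-assoc _ _ _) ⟩
    (f Z A.· f (b B.∧ b')) A.· g₁ (c C.∧ c')       ≡⟨ cong (A._· g₁ (c C.∧ c')) (sym (F.f-·∧ b Z (b B.⇒ b'))) ⟩
    f (b B.· (Z B.∧ (b B.⇒ b'))) A.· g₁ (c C.∧ c') ≡⟨ sym (f̄≡f·g₁ _ _) ⟩
    f̄ (b B.· (Z B.∧ (b B.⇒ b')) , c C.∧ c')        ∎
    where
    Z = g₂ (c C.⇒ c')
    fZ-absorbs : f Z A.· g₁ (c C.· c') ≡ g₁ (c C.· c')
    fZ-absorbs = HA.idempotent-absorbs-≤ (F.f-idempotentOn Z tt) (g₁·≤f∘g₂⇒ c c')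

  f̄-isProductMorphism : IsProductMorphism (⌊ B ⌋ ⋉[ g₂ ] ⌊ C ⌋) ⌊ A ⌋ f̄
  f̄-isProductMorphism = mkIsProductMorphismToHoop A
    (trans (cong₂ A._∧_ (f-one f-pm) (cong proj₁ (f-one g-pm))) (HA.∧-idem A.one))
    (λ { (b , c) (b' , c') _ _ → f̄-· b c b' c' })
    (λ { (b , c) _ → f̄-idempotentOn b c })
    (λ { (b , c) (b' , c') _ _ → f̄-·≡f̄-∧ b c b' c' })

  rightPair : RightPair A B C f̄ g₂
  rightPair = g₂-isProductMorphism , f̄-isProductMorphism

  β∘α-f : ∀ b → β-f A B C f̄ g₂ b ≡ f b
  β∘α-f b = trans (cong (f b A.∧_) (cong proj₁ (f-one g-pm))) (HA.∧-identityʳ (f b))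

  β∘α-g : ∀ c → β-g A B C f̄ g₂ c ≡ g c
  β∘α-g c = cong (_, g₂ c) (trans (HA.∧-comm _ _) (HA.x≤y⇒x∧y≡x (g₁≤f∘g₂ c)))

  private
    L = (⌊ A ⌋ ⋉[ f ] ⌊ B ⌋) ⋉[ g ] ⌊ C ⌋
    R = ⌊ A ⌋ ⋉[ f̄ ] (⌊ B ⌋ ⋉[ g₂ ] ⌊ C ⌋)
    module L = PHoop L
    module R = PHoop R

  reassoc : L.Carrier → R.Carrier
  reassoc ((a , b) , c) = a , (b , c)

  reassoc⁻¹ : R.Carrier → L.Carrier
  reassoc⁻¹ (a , (b , c)) = (a , b) , c

  reassoc-U : ∀ x → L.U x → R.U (reassoc x)
  reassoc-U ((a , b) , c) ((_ , _ , a≤fb) , _ , ab≤gc) =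
    tt , (tt , tt , b≤g₂c) , HA.∧-greatest a≤fb a≤g₁c
    where
    b≤g₂c : b B.≤ g₂ c
    b≤g₂c = cong proj₂ ab≤gc
    a≤g₁c : a A.≤ g₁ c
    a≤g₁c = trans (sym (HA.∧-identityˡ _))
      (trans (cong (A._∧ (a A.⇒ g₁ c)) (sym (trans (cong f b≤g₂c) (f-one f-pm)))) (cong proj₁ ab≤gc))

  reassoc⁻¹-U : ∀ y → R.U y → L.U (reassoc⁻¹ y)
  reassoc⁻¹-U (a , (b , c)) (_ , (_ , _ , b≤g₂c) , a≤f̄bc) =
    (tt , tt , HA.≤-trans a≤f̄bc (HA.x∧y≤x _ _)) , tt ,
    cong₂ _,_ (trans (cong₂ A._∧_ (trans (cong f b≤g₂c) (f-one f-pm)) (HA.≤-trans a≤f̄bc (HA.x∧y≤y _ _)))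
                     (HA.∧-idem A.one))
              b≤g₂c

  reassoc-⇒₁ : ∀ a b c a' b' c' →
    proj₁ (proj₁ (L._⇒_ ((a , b) , c) ((a' , b') , c'))) ≡ proj₁ (R._⇒_ (a , (b , c)) (a' , (b' , c')))
  reassoc-⇒₁ a b c a' b' c' = begin
    G₁ A.· (f (Z B.⇒ W) A.∧ (G₁ A.⇒ (f W A.∧ r)))   ≡⟨ F.⋉-∧-proj₁ (g₁-idempotentOn _) (HA.x∧y≤x (f W) r) ⟩
    G₁ A.· (f W A.∧ r)                                ≡⟨ cong (G₁ A.·_) (HA.idempotent⇒∧≡· (F.f-idempotentOn W tt) r) ⟩
    G₁ A.· (f W A.· r)                                ≡⟨ sym (A.·-assoc _ _ _) ⟩
    (G₁ A.· f W) A.· r                                ≡⟨ cong (A._· r) (A.·-comm G₁ (f W)) ⟩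
    (f W A.· G₁) A.· r                                ≡⟨ cong (A._· r) (sym fZ∧W·G₁≡fW·G₁) ⟩
    (f (Z B.∧ W) A.· G₁) A.· r                        ≡⟨ cong (A._· r) (sym (f̄≡f·g₁ _ _)) ⟩
    f̄ (Z B.∧ W , c C.⇒ c') A.· r                      ≡⟨ sym (HA.idempotent⇒∧≡· (f̄-idempotentOn _ _) r) ⟩
    f̄ (Z B.∧ W , c C.⇒ c') A.∧ r                      ∎
    where
    G₁ = g₁ (c C.⇒ c')
    Z = g₂ (c C.⇒ c')
    W = b B.⇒ b'
    r = a A.⇒ a'
    fZ∧W·G₁≡fW·G₁ : f (Z B.∧ W) A.· G₁ ≡ f W A.· G₁
    fZ∧W·G₁≡fW·G₁ = begin
      f (Z B.∧ W) A.· G₁        ≡⟨ cong (A._· G₁) (sym (F.f·f≡f-∧ Z W tt tt)) ⟩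
      (f Z A.· f W) A.· G₁      ≡⟨ HA.xy∙z≈y∙xz (f Z) (f W) G₁ ⟩
      f W A.· (f Z A.· G₁)      ≡⟨ cong (f W A.·_) (HA.idempotent-absorbs-≤ (F.f-idempotentOn Z tt) (g₁≤f∘g₂ _)) ⟩
      f W A.· G₁                ∎

  reassoc-≅ : L ≅ R
  reassoc-≅ = record
    { to = reassoc
    ; from = reassoc⁻¹
    ; to-U = reassoc-U
    ; from-U = reassoc⁻¹-U
    ; from∘to = λ _ _ → refl
    ; to∘from = λ _ _ → refl
    ; to-one = refl
    ; to-· = λ _ _ _ _ → refl
    ; to-⇒ = λ { ((a , b) , c) ((a' , b') , c') _ _ → cong₂ _,_ (reassoc-⇒₁ a b c a' b' c') refl }
    }

module FromRightPair (A B C : Hoop ℓ) {f : Hoop.Carrier B × Hoop.Carrier C → Hoop.Carrier A}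
                     {g : Hoop.Carrier C → Hoop.Carrier B}
                     (rp : RightPair A B C f g) where
  private
    module A = Hoop A
    module B = Hoop B
    module C = Hoop C
    module HA = HoopProperties A
    module HB = HoopProperties B
    module HC = HoopProperties C
    g-pm = proj₁ rp
    f-pm = proj₂ rp
    module G = HoopProductMorphismProperties C B g-pm
    module F = ProductMorphismIntoHoopProperties A f-pm
    P = ⌊ B ⌋ ⋉[ g ] ⌊ C ⌋
    module P = PHoop P

  f̄ : B.Carrier → A.Carrier
  f̄ = β-f A B C f g

  ḡ : C.Carrier → A.Carrier × B.Carrier
  ḡ = β-g A B C f g

  ⋉-U-one : ∀ b → P.U (b , C.one)
  ⋉-U-one b = tt , tt , trans (cong (b B.⇒_) (f-one g-pm)) (HB.⇒-zeroʳ b)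

  ⋉-U-graph : ∀ c → P.U (g c , c)
  ⋉-U-graph c = tt , tt , B.⇒-refl (g c)

  ⋉-∧-one : ∀ b b' → P._∧_ (b , C.one) (b' , C.one) ≡ (b B.∧ b' , C.one)
  ⋉-∧-one b b' = cong₂ _,_
    (cong (b B.·_) (trans (cong (B._∧ (b B.⇒ b')) (trans (cong g (C.⇒-refl C.one)) (f-one g-pm)))
                          (HB.∧-identityˡ _)))
    (HC.∧-idem C.one)

  ⋉-∧-graph : ∀ c d → P._∧_ (g c , c) (g d , d) ≡ (g (c C.∧ d) , c C.∧ d)
  ⋉-∧-graph c d = cong (_, c C.∧ d)
    (trans (G.⋉-∧-proj₁ (G.f-idempotentOn c tt) (B.⇒-refl (g d))) (G.f·f≡f-∧ c d tt tt))

  f̄-· : ∀ b b' → f̄ b A.· f̄ b' ≡ f̄ (b B.· b')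
  f̄-· b b' = trans (f-· f-pm _ _ (⋉-U-one b) (⋉-U-one b'))
                   (cong (λ u → f (b B.· b' , u)) (C.·-identityʳ C.one))

  f̄-·≡f̄-∧ : ∀ b b' → f̄ (b B.· b') ≡ f̄ (b B.∧ b')
  f̄-·≡f̄-∧ b b' = begin
    f (b B.· b' , C.one)                   ≡⟨ cong (λ u → f (b B.· b' , u)) (sym (C.·-identityʳ C.one)) ⟩
    f (b B.· b' , C.one C.· C.one)         ≡⟨ F.f-·≡f-∧ _ _ (⋉-U-one b) (⋉-U-one b') ⟩
    f (P._∧_ (b , C.one) (b' , C.one))     ≡⟨ cong f (⋉-∧-one b b') ⟩
    f (b B.∧ b' , C.one)                   ∎

  f̄-isProductMorphism : IsProductMorphism ⌊ B ⌋ ⌊ A ⌋ f̄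
  f̄-isProductMorphism = mkIsProductMorphismToHoop A
    (f-one f-pm)
    (λ b b' _ _ → f̄-· b b')
    (λ b _ → F.f-idempotentOn _ (⋉-U-one b))
    (λ b b' _ _ → f̄-·≡f̄-∧ b b')

  private
    module F̄ = HoopProductMorphismProperties B A f̄-isProductMorphism

  -- (g c , c) = (g c , 1) · (g c , c), since g c is idempotent.
  f∘graph≤f̄∘g : ∀ c → f (g c , c) A.≤ f̄ (g c)
  f∘graph≤f̄∘g c = subst (A._≤ f̄ (g c)) f̄gc·fgcc≡fgcc (HA.x·y≤x _ _)
    where
    f̄gc·fgcc≡fgcc : f̄ (g c) A.· f (g c , c) ≡ f (g c , c)
    f̄gc·fgcc≡fgcc = trans (f-· f-pm _ _ (⋉-U-one (g c)) (⋉-U-graph c))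
                          (cong₂ (λ u v → f (u , v)) (G.f-idempotentOn c tt) (C.·-identityˡ c))

  ḡ-· : ∀ c d → PHoop._·_ (⌊ A ⌋ ⋉[ f̄ ] ⌊ B ⌋) (ḡ c) (ḡ d) ≡ ḡ (c C.· d)
  ḡ-· c d = cong₂ _,_
    (trans (f-· f-pm _ _ (⋉-U-graph c) (⋉-U-graph d)) (cong (λ u → f (u , c C.· d)) (f-· g-pm c d tt tt)))
    (f-· g-pm c d tt tt)

  ḡ-∧≡ḡ-· : ∀ c d → PHoop._∧_ (⌊ A ⌋ ⋉[ f̄ ] ⌊ B ⌋) (ḡ c) (ḡ d)
                    ≡ PHoop._·_ (⌊ A ⌋ ⋉[ f̄ ] ⌊ B ⌋) (ḡ c) (ḡ d)
  ḡ-∧≡ḡ-· c d = cong₂ _,_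
    (F̄.⋉-∧-proj₁ (F.f-idempotentOn _ (⋉-U-graph c)) (f∘graph≤f̄∘g d))
    (HB.idempotent⇒∧≡· (G.f-idempotentOn c tt) (g d))

  ḡ-·≡ḡ-∧ : ∀ c d → ḡ (c C.· d) ≡ ḡ (c C.∧ d)
  ḡ-·≡ḡ-∧ c d = cong₂ _,_ f∘graph-·≡f∘graph-∧ (G.f-·≡f-∧ c d tt tt)
    where
    f∘graph-·≡f∘graph-∧ : f (g (c C.· d) , c C.· d) ≡ f (g (c C.∧ d) , c C.∧ d)
    f∘graph-·≡f∘graph-∧ = begin
      f (g (c C.· d) , c C.· d)         ≡⟨ cong (λ u → f (u , c C.· d)) (sym (f-· g-pm c d tt tt)) ⟩
      f (g c B.· g d , c C.· d)         ≡⟨ F.f-·≡f-∧ _ _ (⋉-U-graph c) (⋉-U-graph d) ⟩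
      f (P._∧_ (g c , c) (g d , d))     ≡⟨ cong f (⋉-∧-graph c d) ⟩
      f (g (c C.∧ d) , c C.∧ d)         ∎

  ḡ-isProductMorphism : IsProductMorphism ⌊ C ⌋ (⌊ A ⌋ ⋉[ f̄ ] ⌊ B ⌋) ḡ
  ḡ-isProductMorphism = mkIsProductMorphism
    (λ c _ → tt , tt , f∘graph≤f̄∘g c)
    (cong₂ _,_ (trans (cong (λ u → f (u , C.one)) (f-one g-pm)) (f-one f-pm)) (f-one g-pm))
    (λ c d _ _ → ḡ-· c d)
    (λ c d _ _ → ḡ-∧≡ḡ-· c d)
    (λ c d _ _ → ḡ-·≡ḡ-∧ c d)

  leftPair : LeftPair A B C f̄ ḡ
  leftPair = f̄-isProductMorphism , ḡ-isProductMorphism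

  α∘β-f : ∀ b c → P.U (b , c) → α-f A B C f̄ ḡ (b , c) ≡ f (b , c)
  α∘β-f b c (_ , _ , b≤gc) =
    trans (f-∧ f-pm _ _ (⋉-U-one b) (⋉-U-graph c)) (cong f (cong₂ _,_ b·gc∧b⇒gc≡b (HC.∧-identityˡ c)))
    where
    b·gc∧b⇒gc≡b : b B.· (g (C.one C.⇒ c) B.∧ (b B.⇒ g c)) ≡ b
    b·gc∧b⇒gc≡b = begin
      b B.· (g (C.one C.⇒ c) B.∧ (b B.⇒ g c))  ≡⟨ cong₂ (λ u v → b B.· (g u B.∧ v)) (HC.⇒-identityˡ c) b≤gc ⟩
      b B.· (g c B.∧ B.one)                     ≡⟨ cong (b B.·_) (HB.∧-identityʳ (g c)) ⟩
      b B.· g c                                 ≡⟨ B.·-comm b (g c) ⟩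
      g c B.· b                                 ≡⟨ HB.idempotent-absorbs-≤ (G.f-idempotentOn c tt) b≤gc ⟩
      b                                         ∎

theorem12 : ∀ {ℓ} (A B C : Hoop ℓ) →
    (∀ f g → LeftPair A B C f g → RightPair A B C (α-f A B C f g) (α-g A B C f g))
    × (∀ f g → RightPair A B C f g → LeftPair A B C (β-f A B C f g) (β-g A B C f g))
    × (∀ f g → LeftPair A B C f g →
    (∀ b → β-f A B C (α-f A B C f g) (α-g A B C f g) b ≡ f b)
    × (∀ c → β-g A B C (α-f A B C f g) (α-g A B C f g) c ≡ g c))
    × (∀ f g → RightPair A B C f g →
    (∀ b c → PHoop.U (⌊ B ⌋ ⋉[ g ] ⌊ C ⌋) (b , c) →
    α-f A B C (β-f A B C f g) (β-g A B C f g) (b , c) ≡ f (b , c))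
    × (∀ c → α-g A B C (β-f A B C f g) (β-g A B C f g) c ≡ g c))
    × (∀ f g → LeftPair A B C f g →
    ((⌊ A ⌋ ⋉[ f ] ⌊ B ⌋) ⋉[ g ] ⌊ C ⌋)
    ≅ (⌊ A ⌋ ⋉[ α-f A B C f g ] (⌊ B ⌋ ⋉[ α-g A B C f g ] ⌊ C ⌋)))
theorem12 A B C =
    (λ f g lp → FromLeftPair.rightPair A B C lp)
  , (λ f g rp → FromRightPair.leftPair A B C rp)
  , (λ f g lp → FromLeftPair.β∘α-f A B C lp , FromLeftPair.β∘α-g A B C lp)
  , (λ f g rp → FromRightPair.α∘β-f A B C rp , λ c → refl)
  , (λ f g lp → FromLeftPair.reassoc-≅ A B C lp)
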